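{- Let $i$ be a positive integer, $D$ a nontrivial weakly connected $(i,1)$ digraph, and $f$ an acyclic labeling of $D$. Then every maximal clique $X$ of $P(D)$ equals $N_D^-[x]$, where $x$ is the vertex of $X$ with the least $f$-value among the vertices of $X$.
   Context: All digraphs are finite and simple. An $(i,1)$ digraph is an acyclic digraph in which every vertex has indegree at most $i$ and outdegree at most $1$. Weakly connected means the underlying graph is connected; nontrivial means at least two vertices. For an acyclic digraph $D$, the phylogeny graph $P(D)$ has vertex set $V(D)$, with $u\ne v$ adjacent iff $(u,v)\in A(D)$, or $(v,u)\in A(D)$, or $u$ and $v$ have a common out-neighbor in $D$. For a digraph $D$ with $n$ vertices, an acyclic labeling is a bijection $f:V(D)\to\{1,\dots,n\}$ with $f(u)>f(v)$ for every arc $(u,v)$. $N_D^-[v]$ denotes $\{v\}$ together with the set of in-neighbors of $v$ in $D$. -}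

module Defs where

open import Data.Nat using (ℕ; _≤_; _<_)
open import Data.Fin using (Fin; toℕ)
open import Data.Fin.Subset using (Subset; _∈_; _⊆_)
open import Data.List using (List; length)
open import Data.List.Relation.Unary.All using (All)
open import Data.List.Relation.Unary.Unique.Propositional using (Unique)
open import Data.Product using (_×_; ∃)
open import Data.Sum using (_⊎_)
open import Relation.Nullary using (¬_)
open import Relation.Binary.PropositionalEquality using (_≡_; _≢_)
open import Relation.Binary.Construct.Closure.Transitive using (TransClosure)
open import Relation.Binary.Construct.Closure.ReflexiveTransitive using (Star)
open import Function.Definitions using (Injective)

record Digraph (n : ℕ) : Set₁ where
  field
    Arc  : Fin n → Fin n → Set
    loopless : ∀ v → ¬ Arc v v
open Digraph public

module _ {n : ℕ} (D : Digraph n) where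

  Acyclic : Set
  Acyclic = ∀ v → ¬ TransClosure (Arc D) v v

  InDegAtMost : ℕ → Fin n → Set
  InDegAtMost i v = ∀ (xs : List (Fin n)) → Unique xs → All (λ u → Arc D u v) xs → length xs ≤ i

  OutDegAtMostOne : Fin n → Set
  OutDegAtMostOne v = ∀ w w′ → Arc D v w → Arc D v w′ → w ≡ w′

  Is-i1 : ℕ → Set
  Is-i1 i = Acyclic × (∀ v → InDegAtMost i v) × (∀ v → OutDegAtMostOne v)

  UAdj : Fin n → Fin n → Set
  UAdj u v = Arc D u v ⊎ Arc D v u

  WeaklyConnected : Set
  WeaklyConnected = ∀ u v → Star UAdj u v

  PAdj : Fin n → Fin n → Set
  PAdj u v = u ≢ v × (Arc D u v ⊎ Arc D v u ⊎ ∃ (λ w → Arc D u w × Arc D v w))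

  IsClique : Subset n → Set
  IsClique X = ∀ u v → u ∈ X → v ∈ X → u ≢ v → PAdj u v

  IsMaximalClique : Subset n → Set
  IsMaximalClique X = IsClique X × (∀ Y → IsClique Y → X ⊆ Y → Y ⊆ X)

  -- acyclic labeling: a bijection V(D) → {1..n} (here Fin n, i.e. {0..n-1}) with f(u) > f(v) for arcs (u,v)
  IsAcyclicLabeling : (Fin n → Fin n) → Set
  IsAcyclicLabeling f = Injective _≡_ _≡_ f × (∀ u v → Arc D u v → toℕ (f v) < toℕ (f u))

  InClosedInNbhd : Fin n → Fin n → Set
  InClosedInNbhd x v = v ≡ x ⊎ Arc D v x

-- Only three features of D are used: looplessness, outdegree at most one,
-- and the labeling.
--   * A maximal clique absorbs every vertex P-adjacent to all its members.
--   * Any two distinct vertices of N⁻[x] are P-adjacent (x is a common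
--     out-neighbour), so N⁻[x] ⊆ X as soon as X ⊆ N⁻[x].
--   * Since arcs decrease f, x has no out-neighbour inside X.
--   * If x and another member v of X share an out-neighbour w, outdegree ≤ 1
--     forces w to be P-adjacent to all of X; so w ∈ X, contradicting the
--     previous point.  Hence every other member of X is an in-neighbour of x,
--     i.e. X ⊆ N⁻[x].
module Submission where

open import Defs
open import Data.Nat using (ℕ; _≤_)
open import Data.Nat.Properties using (<⇒≱)
open import Data.Fin using (Fin; toℕ; _≟_)
open import Data.Fin.Subset using (Subset; _∈_; _∪_; ⁅_⁆)
open import Data.Fin.Subset.Properties using (x∈⁅x⁆; x∈⁅y⁆⇒x≡y; p⊆p∪q; x∈p∪q⁻; x∈p∪q⁺)
open import Data.Product using (_,_; proj₁)
open import Data.Sum using (inj₁; inj₂)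
open import Data.Empty using (⊥-elim)
open import Relation.Nullary using (¬_; yes; no)
open import Relation.Binary.PropositionalEquality using (_≢_; refl; sym; trans; subst; ≢-sym)
open import Function.Bundles using (_⇔_; mk⇔)

module _ {n : ℕ} (D : Digraph n) where

  AdjacentToAll : Subset n → Fin n → Set
  AdjacentToAll X w = ∀ y → y ∈ X → y ≢ w → PAdj D y w

  PAdj-sym : ∀ {u v} → PAdj D u v → PAdj D v u
  PAdj-sym (u≢v , inj₁ uv)                   = ≢-sym u≢v , inj₂ (inj₁ uv)
  PAdj-sym (u≢v , inj₂ (inj₁ vu))            = ≢-sym u≢v , inj₁ vu
  PAdj-sym (u≢v , inj₂ (inj₂ (w , uw , vw))) = ≢-sym u≢v , inj₂ (inj₂ (w , vw , uw))

  clique-extend : ∀ {X w} → IsClique D X → AdjacentToAll X w → IsClique D (X ∪ ⁅ w ⁆)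
  clique-extend {X} {w} cl adj u v u∈ v∈ u≢v with x∈p∪q⁻ X ⁅ w ⁆ u∈ | x∈p∪q⁻ X ⁅ w ⁆ v∈
  ... | inj₁ uX | inj₁ vX = cl u v uX vX u≢v
  ... | inj₁ uX | inj₂ vw rewrite x∈⁅y⁆⇒x≡y w vw = adj u uX u≢v
  ... | inj₂ uw | inj₁ vX rewrite x∈⁅y⁆⇒x≡y w uw = PAdj-sym (adj v vX (≢-sym u≢v))
  ... | inj₂ uw | inj₂ vw = ⊥-elim (u≢v (trans (x∈⁅y⁆⇒x≡y w uw) (sym (x∈⁅y⁆⇒x≡y w vw))))

  maximal-absorbs : ∀ {X w} → IsMaximalClique D X → AdjacentToAll X w → w ∈ X
  maximal-absorbs {X} {w} (cl , maximal) adj =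
    maximal (X ∪ ⁅ w ⁆) (clique-extend cl adj) (p⊆p∪q ⁅ w ⁆) (x∈p∪q⁺ (inj₂ (x∈⁅x⁆ w)))

  -- N⁻[x] is a clique of P(D): distinct in-neighbours share the out-neighbour x.
  closedInNbhd-adjacent : ∀ {x u v} → InClosedInNbhd D x u → InClosedInNbhd D x v →
                          u ≢ v → PAdj D u v
  closedInNbhd-adjacent (inj₁ refl) (inj₁ refl) u≢v = ⊥-elim (u≢v refl)
  closedInNbhd-adjacent (inj₁ refl) (inj₂ vx)   u≢v = u≢v , inj₂ (inj₁ vx)
  closedInNbhd-adjacent (inj₂ ux)   (inj₁ refl) u≢v = u≢v , inj₁ ux
  closedInNbhd-adjacent {x} (inj₂ ux) (inj₂ vx) u≢v = u≢v , inj₂ (inj₂ (x , ux , vx))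

  least-label-no-out-arc : ∀ {f X x y} → IsAcyclicLabeling D f →
                           (∀ z → z ∈ X → toℕ (f x) ≤ toℕ (f z)) →
                           y ∈ X → ¬ Arc D x y
  least-label-no-out-arc (_ , decreasing) least y∈X xy = <⇒≱ (decreasing _ _ xy) (least _ y∈X)

  -- If a maximal clique X lies inside N⁻[x], it is all of N⁻[x]: every
  -- vertex of N⁻[x] is adjacent to all of X, hence absorbed.
  closedInNbhd-⊆-maximal : ∀ {X x v} → IsMaximalClique D X →
                           (∀ y → y ∈ X → InClosedInNbhd D x y) →
                           InClosedInNbhd D x v → v ∈ X
  closedInNbhd-⊆-maximal mc X⊆N v∈N =
    maximal-absorbs mc (λ y y∈X y≢v → closedInNbhd-adjacent (X⊆N y y∈X) v∈N y≢v)

  module _ (out : ∀ v → OutDegAtMostOne D v) where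

    -- Members x ≠ v of a clique with a common out-neighbour w leave no room
    -- for an in-neighbour y ≠ w of x in the clique: each way for y and v to be
    -- P-adjacent gives some vertex two distinct out-neighbours.
    no-in-neighbour : ∀ {X x v w y} → IsClique D X → v ∈ X → v ≢ x →
                      Arc D x w → Arc D v w → y ∈ X → y ≢ w → ¬ Arc D y x
    no-in-neighbour {x = x} {v} {w} {y} cl v∈X v≢x xw vw y∈X y≢w yx with y ≟ v
    ... | yes refl = loopless D x (subst (Arc D x) (sym (out y x w yx vw)) xw)
    ... | no y≢v with cl y v y∈X v∈X y≢v
    ... | _ , inj₁ yv                   = v≢x (out y v x yv yx)
    ... | _ , inj₂ (inj₁ vy)            = y≢w (out v y w vy vw)
    ... | _ , inj₂ (inj₂ (u , yu , vu)) =
      loopless D x (subst (Arc D x) (sym (trans (out y x u yx yu) (out v u w vu vw))) xw)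

    -- A common out-neighbour w of two distinct clique members x, v is
    -- P-adjacent to the whole clique: every other member also has an arc to w.
    common-successor-adjacent : ∀ {X x v w} → IsClique D X → x ∈ X → v ∈ X → v ≢ x →
                                Arc D x w → Arc D v w → AdjacentToAll X w
    common-successor-adjacent {x = x} {w = w} cl x∈X v∈X v≢x xw vw y y∈X y≢w with y ≟ x
    ... | yes refl = y≢w , inj₁ xw
    ... | no y≢x with cl y x y∈X x∈X y≢x
    ... | _ , inj₁ yx                   = ⊥-elim (no-in-neighbour cl v∈X v≢x xw vw y∈X y≢w yx)
    ... | _ , inj₂ (inj₁ xy)            = ⊥-elim (y≢w (out x y w xy xw))
    ... | _ , inj₂ (inj₂ (u , yu , xu)) = y≢w , inj₁ (subst (Arc D y) (out x u w xu xw) yu)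

    -- Every member v of a maximal clique X lies in N⁻[x] for the least-labelled
    -- x ∈ X: the arc x → v is excluded by the labeling, and a common
    -- out-neighbour of v and x would be absorbed into X, again excluded.
    maximal-⊆-closedInNbhd : ∀ {f X x v} → IsAcyclicLabeling D f → IsMaximalClique D X →
                             x ∈ X → (∀ z → z ∈ X → toℕ (f x) ≤ toℕ (f z)) →
                             v ∈ X → InClosedInNbhd D x v
    maximal-⊆-closedInNbhd {X = X} {x} {v} lab mc x∈X least v∈X with v ≟ x
    ... | yes v≡x = inj₁ v≡x
    ... | no v≢x with proj₁ mc v x v∈X x∈X v≢x
    ... | _ , inj₁ vx                   = inj₂ vx
    ... | _ , inj₂ (inj₁ xv)            = ⊥-elim (least-label-no-out-arc lab least v∈X xv)
    ... | _ , inj₂ (inj₂ (w , vw , xw)) = ⊥-elim (least-label-no-out-arc lab least w∈X xw)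
      where
      w∈X : w ∈ X
      w∈X = maximal-absorbs mc (common-successor-adjacent (proj₁ mc) x∈X v∈X v≢x xw vw)

-- Lemma 2.3.
lemma2p3 : (i : ℕ) → 1 ≤ i → (n : ℕ) → 2 ≤ n → (D : Digraph n) →
           Is-i1 D i → WeaklyConnected D →
           (f : Fin n → Fin n) → IsAcyclicLabeling D f →
           (X : Subset n) → IsMaximalClique D X →
           (x : Fin n) → x ∈ X → (∀ y → y ∈ X → toℕ (f x) ≤ toℕ (f y)) →
           ∀ v → (v ∈ X ⇔ InClosedInNbhd D x v)
lemma2p3 _ _ _ _ D (_ , _ , out) _ f lab X mc x x∈X least v =
  mk⇔ (X⊆N v) (closedInNbhd-⊆-maximal D mc X⊆N)
  where
  X⊆N : ∀ y → y ∈ X → InClosedInNbhd D x y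
  X⊆N y = maximal-⊆-closedInNbhd D out lab mc x∈X least
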